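{- Let $q,k,d$ be integers, let $G$ be a $(q,k)$-unbreakable graph, and let $S$ be a non-empty skeleton for dominated cluster deletion for parameters $k$ and $d$. Let $X$ be a dominating set of $G$ of size at most $q+d$. Then there is a vertex $v\in S$ such that (1) $v\in X$, or (2) $v\in N(x)$ for some $x\in X$ with $\deg(x)\le q$, or (3) $v\in N(y)$ for some $y\in N(x)$, where $x\in X$, $\deg(x)\le q$ and $\deg(y)\le q$.
   Context: $N(v)$ denotes the open neighbourhood, $N[Y]$ the closed neighbourhood of a set $Y$. A separation of $G$ is $(A,B)$ with $A\cup B=V(G)$ and no edge between $A\setminus B$ and $B\setminus A$, of order $|A\cap B|$; $G$ is $(q,k)$-unbreakable if every separation of order at most $k$ has $|A|\le q$ or $|B|\le q$. The paper tacitly assumes graphs have at least $2q+1$ vertices, so that after deleting at most $k$ vertices of a $(q,k)$-unbreakable graph there is a unique connected component with more than $q$ vertices (the large component). A set $S\subseteq V(G)$ is a skeleton for dominated cluster deletion for parameters $k,d$ if there is $S'\supseteq S$ with $|S'|\le k$ such that every connected component of $G-S'$ has a dominating set of size at most $d$, and $S$ consists exactly of the vertices of $S'$ that have at least one neighbour in $C'_0$ and at least one neighbour in $G-N[C'_0]$, where $C'_0$ is the large connected component (the one with more than $q$ vertices) of $G-S'$. -}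

module Defs where

open import Data.Nat using (ℕ; _≤_; _<_)
open import Data.Bool using (Bool; true; false; T)
open import Data.Fin using (Fin)
open import Data.Fin.Subset using (Subset; _∈_; _∉_; ∣_∣; _∪_; _∩_; _⊆_; ⊤)
open import Data.Vec using (tabulate)
open import Data.Product using (Σ; ∃; ∃-syntax; _×_)
open import Data.Sum using (_⊎_)
open import Relation.Binary.PropositionalEquality using (_≡_)
open import Relation.Nullary using (¬_)
open import Function.Bundles using (_⇔_)

record Graph (n : ℕ) : Set where
  field
    adj     : Fin n → Fin n → Bool
    adj-sym : ∀ u v → adj u v ≡ adj v u
    irrefl  : ∀ v → adj v v ≡ false

module _ {n : ℕ} (G : Graph n) where
  open Graph G

  Adj : Fin n → Fin n → Set
  Adj u v = T (adj u v)

  N : Fin n → Subset n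
  N v = tabulate (λ u → adj v u)

  deg : Fin n → ℕ
  deg v = ∣ N v ∣

  InClosedNbhd : Subset n → Fin n → Set
  InClosedNbhd Y u = u ∈ Y ⊎ ∃[ y ] (y ∈ Y × Adj y u)

  IsSeparation : Subset n → Subset n → Set
  IsSeparation A B =
    (A ∪ B ≡ ⊤) ×
    (∀ u v → u ∈ A → u ∉ B → v ∈ B → v ∉ A → ¬ Adj u v)

  Unbreakable : ℕ → ℕ → Set
  Unbreakable q k = ∀ A B → IsSeparation A B → ∣ A ∩ B ∣ ≤ k →
                    ∣ A ∣ ≤ q ⊎ ∣ B ∣ ≤ q

  data Reach (W : Subset n) (v : Fin n) : Fin n → Set where
    here : v ∈ W → Reach W v v
    step : ∀ {w u} → Reach W v w → Adj w u → u ∈ W → Reach W v u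

  IsComponentOfDel : Subset n → Subset n → Set
  IsComponentOfDel S' C =
    ∃[ v ] (v ∉ S' × (∀ u → u ∈ C ⇔ Reach (Data.Fin.Subset.∁ S') v u))

  DominatesIn : Subset n → Subset n → Set
  DominatesIn C D = D ⊆ C × (∀ u → u ∈ C → u ∈ D ⊎ ∃[ x ] (x ∈ D × Adj x u))

  Dominating : Subset n → Set
  Dominating X = ∀ u → u ∈ X ⊎ ∃[ x ] (x ∈ X × Adj x u)

  -- S is a skeleton for dominated cluster deletion for parameters k, d
  -- (q is the unbreakability parameter defining the large component)
  IsSkeleton : ℕ → ℕ → ℕ → Subset n → Set
  IsSkeleton q k d S =
    ∃[ S' ] (S ⊆ S' × ∣ S' ∣ ≤ k ×
      (∀ C → IsComponentOfDel S' C → ∃[ D ] (DominatesIn C D × ∣ D ∣ ≤ d)) ×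
      ∃[ C₀ ] (IsComponentOfDel S' C₀ × q < ∣ C₀ ∣ ×
        (∀ v → v ∈ S ⇔
          (v ∈ S' × ∃[ u ] (u ∈ C₀ × Adj v u)
                  × ∃[ u ] (¬ InClosedNbhd C₀ u × Adj v u)))))

{-# OPTIONS --safe #-}

-- Since G is (q,k)-unbreakable and |S'| ≤ k, the separation (C₀ ∪ S', V ∖ C₀)
-- of order at most |S'| has the side V ∖ C₀ of size at most q, because the
-- other side contains the large component C₀.  Hence every vertex outside
-- N[C₀] has degree at most q.  Take s ∈ S with a neighbour w outside N[C₀].
-- If w ∈ X, then (2) holds for s.  Otherwise some x ∈ X is adjacent to w, so
-- x ∉ C₀.  If x has a neighbour in C₀, then x ∈ S' (else it would belong to
-- C₀), so x is a skeleton vertex and (1) holds for x; if not, x lies outside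
-- N[C₀] and (3) holds for s with y = w.
module Submission where

open import Defs
open import Data.Nat using (ℕ; _≤_; _<_; _+_)
open import Data.Nat.Properties using (≤-trans; <-≤-trans; <⇒≱)
open import Data.Bool using (T; T?)
open import Data.Bool.Properties using (T-≡)
open import Data.Fin.Subset using (Subset; _∈_; _∉_; ∣_∣; _∪_; _∩_; _⊆_; ∁; ⊤)
open import Data.Fin.Subset.Properties
  using (_∈?_; ⊆⊤; ⊆-antisym; p∪∁p≡⊤; p⊆q⇒∣p∣≤∣q∣; ∣p∣≤∣p∪q∣;
         x∈p∪q⁺; x∈p∪q⁻; x∈p∩q⁻; x∈∁p⇒x∉p; x∉p⇒x∈∁p; x∉∁p⇒x∈p)
open import Data.Fin.Properties using (any?)
open import Data.Vec.Properties using ([]=⇒lookup; lookup∘tabulate)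
open import Data.Product using (∃-syntax; _×_; _,_; proj₁; proj₂)
open import Data.Sum using (_⊎_; inj₁; inj₂)
import Data.Sum as Sum
open import Data.Empty using (⊥-elim)
open import Relation.Nullary using (¬_; yes; no)
open import Relation.Nullary.Decidable using (_×-dec_)
open import Relation.Binary.PropositionalEquality using (trans; sym; subst)
open import Function.Base using (case_of_)
open import Function.Bundles using (_⇔_; Equivalence)

open Equivalence using (to; from)

module _ {n : ℕ} (G : Graph n) where
  open Graph G

  Adj-sym : ∀ {u v} → Adj G u v → Adj G v u
  Adj-sym {u} {v} = subst T (adj-sym u v)

  ∈N⇒Adj : ∀ {v u} → u ∈ N G v → Adj G v u
  ∈N⇒Adj {v} {u} u∈Nv =
    from T-≡ (trans (sym (lookup∘tabulate (adj v) u)) ([]=⇒lookup u∈Nv))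

  ∉N[C]⇒N⊆∁C : ∀ {C z} → ¬ InClosedNbhd G C z → N G z ⊆ ∁ C
  ∉N[C]⇒N⊆∁C z∉N[C] u∈Nz = x∉p⇒x∈∁p (λ u∈C → z∉N[C] (inj₂ (_ , u∈C , Adj-sym (∈N⇒Adj u∈Nz))))

  ∉N[C]⇒deg≤∣∁C∣ : ∀ {C z} → ¬ InClosedNbhd G C z → deg G z ≤ ∣ ∁ C ∣
  ∉N[C]⇒deg≤∣∁C∣ z∉N[C] = p⊆q⇒∣p∣≤∣q∣ (∉N[C]⇒N⊆∁C z∉N[C])

  Adj-∉N[C]⇒∉C : ∀ {C w x} → ¬ InClosedNbhd G C w → Adj G x w → x ∉ C
  Adj-∉N[C]⇒∉C w∉N[C] x~w x∈C = w∉N[C] (inj₂ (_ , x∈C , x~w))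

  module Component {S' C : Subset n} (C-comp : IsComponentOfDel G S' C) where
    private
      ∈C⇔Reach : ∀ u → u ∈ C ⇔ Reach G (∁ S') (proj₁ C-comp) u
      ∈C⇔Reach = proj₂ (proj₂ C-comp)

    Adj-closed : ∀ {u v} → u ∈ C → Adj G u v → v ∉ S' → v ∈ C
    Adj-closed {u} {v} u∈C u~v v∉S' =
      from (∈C⇔Reach v) (step (to (∈C⇔Reach u) u∈C) u~v (x∉p⇒x∈∁p v∉S'))

    separation : IsSeparation G (C ∪ S') (∁ C)
    separation = ⊆-antisym ⊆⊤ covers , no-edge
      where
      covers : ⊤ ⊆ (C ∪ S') ∪ ∁ C
      covers {x} x∈⊤ = x∈p∪q⁺ (Sum.map₁ (λ x∈C → x∈p∪q⁺ (inj₁ x∈C))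
                         (x∈p∪q⁻ C (∁ C) (subst (x ∈_) (sym (p∪∁p≡⊤ C)) x∈⊤)))

      no-edge : ∀ u v → u ∈ C ∪ S' → u ∉ ∁ C → v ∈ ∁ C → v ∉ C ∪ S' → ¬ Adj G u v
      no-edge u v _ u∉∁C _ v∉C∪S' u~v =
        v∉C∪S' (x∈p∪q⁺ (inj₁ (Adj-closed (x∉∁p⇒x∈p u∉∁C) u~v
                                          (λ v∈S' → v∉C∪S' (x∈p∪q⁺ (inj₂ v∈S'))))))

    separator⊆S' : (C ∪ S') ∩ ∁ C ⊆ S'
    separator⊆S' x∈sep with x∈p∩q⁻ (C ∪ S') (∁ C) x∈sep
    ... | x∈C∪S' , x∈∁C = Sum.[ (λ x∈C → ⊥-elim (x∈∁p⇒x∉p x∈∁C x∈C)) , (λ x∈S' → x∈S') ]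
                            (x∈p∪q⁻ C S' x∈C∪S')

    large⇒∣∁C∣≤ : ∀ {q k} → Unbreakable G q k → ∣ S' ∣ ≤ k → q < ∣ C ∣ → ∣ ∁ C ∣ ≤ q
    large⇒∣∁C∣≤ unbreakable ∣S'∣≤k q<∣C∣
      with unbreakable (C ∪ S') (∁ C) separation (≤-trans (p⊆q⇒∣p∣≤∣q∣ separator⊆S') ∣S'∣≤k)
    ... | inj₁ ∣C∪S'∣≤q = ⊥-elim (<⇒≱ (<-≤-trans q<∣C∣ (∣p∣≤∣p∪q∣ C S')) ∣C∪S'∣≤q)
    ... | inj₂ ∣∁C∣≤q   = ∣∁C∣≤q

    ∉N[C]⇒deg≤q : ∀ {q k z} → Unbreakable G q k → ∣ S' ∣ ≤ k → q < ∣ C ∣ →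
                   ¬ InClosedNbhd G C z → deg G z ≤ q
    ∉N[C]⇒deg≤q unbreakable ∣S'∣≤k q<∣C∣ z∉N[C] =
      ≤-trans (∉N[C]⇒deg≤∣∁C∣ z∉N[C]) (large⇒∣∁C∣≤ unbreakable ∣S'∣≤k q<∣C∣)

    ∉C∧Adj⇒∈S' : ∀ {x u} → x ∉ C → u ∈ C → Adj G x u → x ∈ S'
    ∉C∧Adj⇒∈S' x∉C u∈C x~u =
      x∉∁p⇒x∈p (λ x∈∁S' → x∉C (Adj-closed u∈C (Adj-sym x~u) (x∈∁p⇒x∉p x∈∁S')))

    ∉N[C]-neighbour : ∀ {w x} → ¬ InClosedNbhd G C w → Adj G x w →
                      (x ∈ S' × ∃[ u ] (u ∈ C × Adj G x u)) ⊎ ¬ InClosedNbhd G C x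
    ∉N[C]-neighbour {w} {x} w∉N[C] x~w with any? (λ u → (u ∈? C) ×-dec T? (adj x u))
    ... | yes (u , u∈C , x~u) =
      inj₁ (∉C∧Adj⇒∈S' (Adj-∉N[C]⇒∉C w∉N[C] x~w) u∈C x~u , u , u∈C , x~u)
    ... | no x≁C = inj₂ Sum.[ Adj-∉N[C]⇒∉C w∉N[C] x~w
                            , (λ (u , u∈C , u~x) → x≁C (u , u∈C , Adj-sym u~x)) ]

lemma10 : ∀ {n} (G : Graph n) (q k d : ℕ) → q + q < n →
    Unbreakable G q k →
    (S : Subset n) → IsSkeleton G q k d S → ∃[ s ] (s ∈ S) →
    (X : Subset n) → Dominating G X → ∣ X ∣ ≤ q + d →
    ∃[ v ] (v ∈ S ×
      (v ∈ X
      ⊎ ∃[ x ] (x ∈ X × deg G x ≤ q × Adj G x v)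
      ⊎ ∃[ x ] ∃[ y ] (x ∈ X × deg G x ≤ q × Adj G x y × deg G y ≤ q × Adj G y v)))
lemma10 G q k d _ unbreakable S (S' , _ , ∣S'∣≤k , _ , C₀ , C₀-comp , q<∣C₀∣ , ∈S⇔) (s , s∈S) X dominating _ =
  case s-far-neighbour of λ where
    (w , w∉N[C₀] , s~w) → case dominating w of λ where
      (inj₁ w∈X) → s , s∈S , inj₂ (inj₁ (w , w∈X , low-deg w∉N[C₀] , Adj-sym G s~w))
      (inj₂ (x , x∈X , x~w)) → case ∉N[C]-neighbour w∉N[C₀] x~w of λ where
        (inj₁ (x∈S' , u , u∈C₀ , x~u)) →
          x , from (∈S⇔ x) (x∈S' , u , (u∈C₀ , x~u) , w , w∉N[C₀] , x~w) , inj₁ x∈X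
        (inj₂ x∉N[C₀]) →
          s , s∈S , inj₂ (inj₂ (x , w , x∈X , low-deg x∉N[C₀] , x~w , low-deg w∉N[C₀] , Adj-sym G s~w))
  where
  open Component G C₀-comp

  s-far-neighbour : ∃[ w ] (¬ InClosedNbhd G C₀ w × Adj G s w)
  s-far-neighbour = proj₂ (proj₂ (proj₂ (to (∈S⇔ s) s∈S)))

  low-deg : ∀ {z} → ¬ InClosedNbhd G C₀ z → deg G z ≤ q
  low-deg = ∉N[C]⇒deg≤q unbreakable ∣S'∣≤k q<∣C₀∣
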